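{- A bipartite graph $B=(X,Y,E)$ is an ACB graph if and only if $split_X(B)$ is auto-strongly-chordal, and also if and only if $split_Y(B)$ is auto-strongly-chordal.
   Context: For a bipartite graph $B=(X,Y,E)$ with color classes $X,Y$, $split_X(B)$ (resp. $split_Y(B)$) is the split graph obtained from $B$ by adding all edges between vertices of $X$ (resp. of $Y$), making it a clique. Chordal bipartite: no induced $C_{2k}$, $k\ge3$. The mirror $mir(B)$ has the same color classes with $xy$ ($x\in X,y\in Y$) an edge iff it is not an edge of $B$. $B$ is ACB if $B$ and $mir(B)$ are chordal bipartite. A graph is strongly chordal if it is chordal (no induced $C_k$, $k\ge4$) and contains no induced $k$-sun $S_k$ ($k\ge3$; clique $q_0,\dots,q_{k-1}$, stable set $s_0,\dots,s_{k-1}$, $s_i$ adjacent exactly to $q_i,q_{i+1}$ mod $k$). A graph $G$ is auto-strongly-chordal if $G$ and its complement $\overline{G}$ are strongly chordal. -}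

module Defs where

open import Data.Nat using (ℕ; zero; suc; _≤_; _*_)
open import Data.Fin using (Fin; toℕ)
open import Data.Sum using (_⊎_; inj₁; inj₂)
open import Data.Product using (Σ; _×_; _,_)
open import Data.Empty using (⊥)
open import Data.Bool using (Bool; true; not)
open import Relation.Nullary using (¬_)
open import Relation.Binary.PropositionalEquality using (_≡_; _≢_; sym)
open import Function.Definitions using (Injective)
open import Function.Bundles using (_⇔_)

record Graph : Set₁ where
  field
    V     : Set
    _~_   : V → V → Set
    ~-sym : ∀ {u v} → u ~ v → v ~ u
    ~-irr : ∀ {v} → ¬ (v ~ v)

open Graph public

complement : Graph → Graph
complement G = record
  { V = V G
  ; _~_ = λ u v → (u ≢ v) × ¬ (_~_ G u v)
  ; ~-sym = λ { (ne , na) → (λ e → ne (sym e)) , (λ a → na (~-sym G a)) }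
  ; ~-irr = λ { (ne , _) → ne _≡_.refl }
  }

cycSucc : ∀ {k} → Fin k → Fin k → Set
cycSucc {k} i j = (suc (toℕ i) ≡ toℕ j) ⊎ ((suc (toℕ i) ≡ k) × (toℕ j ≡ 0))

InducedCycle : (G : Graph) → ℕ → Set
InducedCycle G k =
  Σ (Fin k → V G) λ f →
    Injective _≡_ _≡_ f ×
    (∀ i j → (_~_ G (f i) (f j) ⇔ (cycSucc i j ⊎ cycSucc j i)))

-- An induced k-sun: clique q_0..q_{k-1}, stable set s_0..s_{k-1} (all 2k
-- vertices distinct), s_i adjacent exactly to q_i and q_{i+1 mod k}.
InducedSun : (G : Graph) → ℕ → Set
InducedSun G k =
  Σ (Fin k ⊎ Fin k → V G) λ f →
    Injective _≡_ _≡_ f ×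
    (∀ i j → i ≢ j → _~_ G (f (inj₁ i)) (f (inj₁ j))) ×
    (∀ i j → ¬ (_~_ G (f (inj₂ i)) (f (inj₂ j)))) ×
    (∀ i j → (_~_ G (f (inj₂ i)) (f (inj₁ j)) ⇔ ((j ≡ i) ⊎ cycSucc i j)))

Chordal : Graph → Set
Chordal G = ∀ k → 4 ≤ k → ¬ InducedCycle G k

StronglyChordal : Graph → Set
StronglyChordal G = Chordal G × (∀ k → 3 ≤ k → ¬ InducedSun G k)

AutoStronglyChordal : Graph → Set
AutoStronglyChordal G = StronglyChordal G × StronglyChordal (complement G)

record BipGraph : Set₁ where
  field
    m n : ℕ
    E   : Fin m → Fin n → Bool

open BipGraph public

bipAdj : (B : BipGraph) → Fin (m B) ⊎ Fin (n B) → Fin (m B) ⊎ Fin (n B) → Set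
bipAdj B (inj₁ x) (inj₂ y) = E B x y ≡ true
bipAdj B (inj₂ y) (inj₁ x) = E B x y ≡ true
bipAdj B (inj₁ _) (inj₁ _) = ⊥
bipAdj B (inj₂ _) (inj₂ _) = ⊥

toGraph : BipGraph → Graph
toGraph B = record
  { V = Fin (m B) ⊎ Fin (n B)
  ; _~_ = bipAdj B
  ; ~-sym = λ { {inj₁ _} {inj₂ _} e → e ; {inj₂ _} {inj₁ _} e → e
              ; {inj₁ _} {inj₁ _} () ; {inj₂ _} {inj₂ _} () }
  ; ~-irr = λ { {inj₁ _} () ; {inj₂ _} () }
  }

mirror : BipGraph → BipGraph
mirror B = record { m = m B ; n = n B ; E = λ x y → not (E B x y) }

ChordalBipartite : BipGraph → Set
ChordalBipartite B = ∀ k → 3 ≤ k → ¬ InducedCycle (toGraph B) (2 * k)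

ACB : BipGraph → Set
ACB B = ChordalBipartite B × ChordalBipartite (mirror B)

splitXAdj : (B : BipGraph) → Fin (m B) ⊎ Fin (n B) → Fin (m B) ⊎ Fin (n B) → Set
splitXAdj B (inj₁ x) (inj₁ x') = x ≢ x'
splitXAdj B u v = bipAdj B u v

splitX : BipGraph → Graph
splitX B = record
  { V = Fin (m B) ⊎ Fin (n B)
  ; _~_ = splitXAdj B
  ; ~-sym = λ { {inj₁ _} {inj₁ _} ne e → ne (sym e)
              ; {inj₁ _} {inj₂ _} e → e ; {inj₂ _} {inj₁ _} e → e
              ; {inj₂ _} {inj₂ _} () }
  ; ~-irr = λ { {inj₁ _} ne → ne _≡_.refl ; {inj₂ _} () }
  }

splitYAdj : (B : BipGraph) → Fin (m B) ⊎ Fin (n B) → Fin (m B) ⊎ Fin (n B) → Set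
splitYAdj B (inj₂ y) (inj₂ y') = y ≢ y'
splitYAdj B u v = bipAdj B u v

splitY : BipGraph → Graph
splitY B = record
  { V = Fin (m B) ⊎ Fin (n B)
  ; _~_ = splitYAdj B
  ; ~-sym = λ { {inj₂ _} {inj₂ _} ne e → ne (sym e)
              ; {inj₁ _} {inj₂ _} e → e ; {inj₂ _} {inj₁ _} e → e
              ; {inj₁ _} {inj₁ _} () }
  ; ~-irr = λ { {inj₂ _} ne → ne _≡_.refl ; {inj₁ _} () }
  }

module Submission where

-- A split graph (clique ∪ stable set) has no induced cycle of
-- length ≥ 4, and in an induced k-sun (k ≥ 3) of a split graph the sun's
-- clique lies in the clique part and its stable set in the stable part.  In
-- split_X(B) the edges between the parts are those of B, so a k-sun of
-- split_X(B) is an induced 2k-cycle q₀ s₀ q₁ s₁ … of B with all qᵢ in X (an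
-- "alternating cycle"); as every induced 2k-cycle of B can be rotated to start
-- in X, split_X(B) is strongly chordal iff B is chordal bipartite.  The
-- corollary follows via the isomorphisms split_Y(B) ≅ split_X(Bᵀ),
-- complement(split_X B) ≅ split_Y(mir B), complement(split_Y B) ≅ split_X(mir B)
-- and Bᵀ ≅ B (Bᵀ exchanges the colour classes), since induced cycles and suns
-- are carried along isomorphisms.

open import Defs
open import Data.Bool using (Bool; true; false; not)
open import Data.Bool.Properties using (not-involutive)
open import Data.Empty using (⊥; ⊥-elim)
open import Data.Fin using (Fin; toℕ; fromℕ<; #_) renaming (zero to fzero; suc to fsuc)
open import Data.Fin.Properties using (toℕ-fromℕ<; fromℕ<-toℕ; toℕ-injective; toℕ<n)
open import Data.Nat using (ℕ; zero; suc; _≤_; _<_; _+_; _*_; z≤n; s≤s)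
open import Data.Nat.Properties using (+-suc; suc-injective; ≤-trans; n≤1+n; ≤∧≢⇒<; <⇒≢; _≟_)
open import Data.Product using (Σ; _×_; _,_; proj₁; proj₂)
open import Data.Product.Function.NonDependent.Propositional using (_×-⇔_)
open import Data.Sum.Function.Propositional using (_⊎-⇔_)
open import Data.Sum using (_⊎_; inj₁; inj₂; [_,_]; swap) renaming (map to ⊎-map)
open import Data.Sum.Properties using (inj₁-injective; inj₂-injective; swap-involutive)
open import Function.Base using (id; _∘_)
open import Function.Bundles using (_⇔_; mk⇔; Equivalence)
open import Function.Definitions using (Injective)
import Function.Properties.Equivalence as ⇔
open import Relation.Nullary using (¬_; yes; no)
open import Relation.Binary.PropositionalEquality
  using (_≡_; _≢_; refl; sym; trans; cong; subst; subst₂; module ≡-Reasoning)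

open Equivalence using (to; from)

retraction⇒injective : ∀ {A B : Set} {f : A → B} (g : B → A) →
                       (∀ x → g (f x) ≡ x) → Injective _≡_ _≡_ f
retraction⇒injective {f = f} g gf {x} {y} fx≡fy =
  trans (sym (gf x)) (trans (cong g fx≡fy) (gf y))

inj₂≢inj₁ : ∀ {A B : Set} {a : A} {b : B} → inj₂ b ≢ inj₁ a
inj₂≢inj₁ ()

clash : ∀ {b : Bool} → b ≡ true → b ≡ false → ⊥
clash refl ()

record _↪ᵢ_ (H G : Graph) : Set where
  field
    vmap      : V H → V G
    injective : Injective _≡_ _≡_ vmap
    adjacency : ∀ u v → _~_ H u v ⇔ _~_ G (vmap u) (vmap v)

module _ {H G : Graph} (e : H ↪ᵢ G) where
  open _↪ᵢ_ e

  cycle-↪ : ∀ {k} → InducedCycle H k → InducedCycle G k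
  cycle-↪ (f , inj , adj) =
    vmap ∘ f , inj ∘ injective , λ i j → ⇔.trans (⇔.sym (adjacency _ _)) (adj i j)

  sun-↪ : ∀ {k} → InducedSun H k → InducedSun G k
  sun-↪ (f , inj , cliq , stab , pat) =
    vmap ∘ f , inj ∘ injective ,
    (λ i j i≢j → to (adjacency _ _) (cliq i j i≢j)) ,
    (λ i j adj → stab i j (from (adjacency _ _) adj)) ,
    λ i j → ⇔.trans (⇔.sym (adjacency _ _)) (pat i j)

  stronglyChordal-↪ : StronglyChordal G → StronglyChordal H
  stronglyChordal-↪ (chordal , sunFree) =
    (λ k 4≤k c → chordal k 4≤k (cycle-↪ c)) , λ k 3≤k s → sunFree k 3≤k (sun-↪ s)

record _≅_ (H G : Graph) : Set where
  field
    embedding : H ↪ᵢ G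
    section   : V G → V H
    onto      : ∀ v → _↪ᵢ_.vmap embedding (section v) ≡ v

  open _↪ᵢ_ embedding

  inverse : G ↪ᵢ H
  inverse = record
    { vmap      = section
    ; injective = retraction⇒injective vmap onto
    ; adjacency = λ u v → subst₂ (λ a b → _~_ G a b ⇔ _~_ H (section u) (section v))
                                 (onto u) (onto v) (⇔.sym (adjacency _ _))
    }

open _≅_ using (embedding; inverse)

stronglyChordal-≅ : ∀ {H G} → H ≅ G → StronglyChordal H ⇔ StronglyChordal G
stronglyChordal-≅ iso =
  mk⇔ (stronglyChordal-↪ (inverse iso)) (stronglyChordal-↪ (embedding iso))

bijectionIso : ∀ {H G : Graph} (φ : V H → V G) (ψ : V G → V H) →
                (∀ v → φ (ψ v) ≡ v) → (∀ v → ψ (φ v) ≡ v) →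
                (∀ u v → _~_ H u v ⇔ _~_ G (φ u) (φ v)) → H ≅ G
bijectionIso φ ψ φψ ψφ adj = record
  { embedding = record { vmap = φ ; injective = retraction⇒injective ψ ψφ ; adjacency = adj }
  ; section   = ψ
  ; onto      = φψ
  }

record SplitPartition (G : Graph) : Set where
  field
    inClique : V G → Bool
    clique   : ∀ {u v} → inClique u ≡ true → inClique v ≡ true → u ≢ v → _~_ G u v
    stable   : ∀ {u v} → inClique u ≡ false → inClique v ≡ false → ¬ _~_ G u v

module CycleFacts {G : Graph} {N : ℕ} (c : InducedCycle G N) where
  vertex : Fin N → V G
  vertex = proj₁ c

  consecutive : ∀ {i j} → cycSucc i j → _~_ G (vertex i) (vertex j)
  consecutive i→j = from (proj₂ (proj₂ c) _ _) (inj₁ i→j)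

  nonconsecutive : ∀ {i j} → ¬ cycSucc i j → ¬ cycSucc j i → ¬ _~_ G (vertex i) (vertex j)
  nonconsecutive i↛j j↛i adj = [ i↛j , j↛i ] (to (proj₂ (proj₂ c) _ _) adj)

  distinct : ∀ {i j} → i ≢ j → vertex i ≢ vertex j
  distinct i≢j eq = i≢j (proj₁ (proj₂ c) eq)

farIndex : ∀ {k} → 3 ≤ k → (i : Fin k) → Σ (Fin k) λ j → (j ≢ i) × ¬ cycSucc i j
farIndex (s≤s (s≤s (s≤s _))) fzero               = # 2 , (λ ()) , λ { (inj₁ ()) ; (inj₂ (() , _)) }
farIndex (s≤s (s≤s (s≤s _))) (fsuc fzero)        = # 0 , (λ ()) , λ { (inj₁ ()) ; (inj₂ (() , _)) }
farIndex (s≤s (s≤s (s≤s _))) (fsuc (fsuc i))     = # 1 , (λ ()) , λ { (inj₁ ()) ; (inj₂ (_ , ())) }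

module SplitGraph {G : Graph} (P : SplitPartition G) where
  open SplitPartition P

  neighbourOfStable : ∀ {u v} → inClique u ≡ false → _~_ G u v → inClique v ≡ true
  neighbourOfStable {v = v} u∉K u~v with inClique v in v∈?
  ... | true  = refl
  ... | false = ⊥-elim (stable u∉K v∈? u~v)

  nonNeighbourOfClique : ∀ {u v} → inClique u ≡ true → u ≢ v → ¬ _~_ G u v → inClique v ≡ false
  nonNeighbourOfClique {v = v} u∈K u≢v u≁v with inClique v in v∈?
  ... | true  = ⊥-elim (u≁v (clique u∈K v∈? u≢v))
  ... | false = refl

  -- The middle vertex b of an induced path a – b – c lies in the clique:
  -- otherwise a and c would both be clique vertices, yet non-adjacent.
  middleInClique : ∀ {a b c} → _~_ G a b → _~_ G b c → a ≢ c → ¬ _~_ G a c →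
                   inClique b ≡ true
  middleInClique {b = b} a~b b~c a≢c a≁c with inClique b in b∈?
  ... | true  = refl
  ... | false = ⊥-elim (clash (neighbourOfStable b∈? b~c)
                              (nonNeighbourOfClique (neighbourOfStable b∈? (~-sym G a~b)) a≢c a≁c))

  cycleMiddle : ∀ {N} (c : InducedCycle G N) {i j l : Fin N} →
                cycSucc i j → cycSucc j l → i ≢ l → ¬ cycSucc i l → ¬ cycSucc l i →
                inClique (proj₁ c j) ≡ true
  cycleMiddle c i→j j→l i≢l i↛l l↛i =
    middleInClique (consecutive i→j) (consecutive j→l) (distinct i≢l) (nonconsecutive i↛l l↛i)
    where open CycleFacts {G} c

  -- In a cycle of length ≥ 4, position 3 is the middle of 2 → 3 → (3+1 mod k).
  position3InClique : ∀ M (c : InducedCycle G (4 + M)) → inClique (proj₁ c (# 3)) ≡ true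
  position3InClique zero c =
    cycleMiddle c {# 2} {# 3} {# 0} (inj₁ refl) (inj₂ (refl , refl)) (λ ())
                (λ { (inj₁ ()) ; (inj₂ (() , _)) }) (λ { (inj₁ ()) ; (inj₂ (() , _)) })
  position3InClique (suc M) c =
    cycleMiddle c {# 2} {# 3} {# 4} (inj₁ refl) (inj₁ refl) (λ ())
                (λ { (inj₁ ()) ; (inj₂ (() , _)) }) (λ { (inj₁ ()) ; (inj₂ (_ , ())) })

  -- Split graphs are chordal: in an induced cycle of length ≥ 4 positions 1
  -- and 3 are both middles of induced paths, hence clique vertices, but they
  -- are non-adjacent.
  splitChordal : Chordal G
  splitChordal (suc (suc (suc (suc M)))) (s≤s (s≤s (s≤s (s≤s _)))) c =
    clash (position3InClique M c) (nonNeighbourOfClique position1InClique (distinct (λ ()))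
                                     (nonconsecutive (λ { (inj₁ ()) ; (inj₂ (() , _)) })
                                                     (λ { (inj₁ ()) ; (inj₂ (_ , ())) })))
    where
      open CycleFacts {G} c
      position1InClique : inClique (vertex (# 1)) ≡ true
      position1InClique =
        cycleMiddle c {# 0} {# 1} {# 2} (inj₁ refl) (inj₁ refl) (λ ())
                    (λ { (inj₁ ()) ; (inj₂ (() , _)) }) (λ { (inj₁ ()) ; (inj₂ (() , _)) })

  sunPlacement : ∀ {k} → 3 ≤ k → (s : InducedSun G k) →
                 (∀ i → inClique (proj₁ s (inj₁ i)) ≡ true) × (∀ i → inClique (proj₁ s (inj₂ i)) ≡ false)
  sunPlacement 3≤k (f , inj , _ , stab , pat) = qInClique , sStable
    where
      -- If s_i were a clique vertex, take j ∉ {i, i+1}: then q_j is not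
      -- adjacent to s_i, so q_j is stable, so its neighbour s_j is a clique
      -- vertex, contradicting that s_j and s_i are non-adjacent.
      notInClique : ∀ i → inClique (f (inj₂ i)) ≡ true → ⊥
      notInClique i sᵢ∈K with farIndex 3≤k i
      ... | j , j≢i , i↛j = clash sⱼ∈K sⱼ∉K
        where
          qⱼ∉K : inClique (f (inj₁ j)) ≡ false
          qⱼ∉K = nonNeighbourOfClique sᵢ∈K (λ eq → inj₂≢inj₁ (inj eq))
                   (λ adj → [ j≢i , i↛j ] (to (pat i j) adj))
          sⱼ∈K : inClique (f (inj₂ j)) ≡ true
          sⱼ∈K = neighbourOfStable qⱼ∉K (~-sym G (from (pat j j) (inj₁ refl)))
          sⱼ∉K : inClique (f (inj₂ j)) ≡ false
          sⱼ∉K = nonNeighbourOfClique sᵢ∈K (λ eq → j≢i (sym (inj₂-injective (inj eq)))) (stab i j)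

      sStable : ∀ i → inClique (f (inj₂ i)) ≡ false
      sStable i with inClique (f (inj₂ i)) in sᵢ∈?
      ... | true  = ⊥-elim (notInClique i sᵢ∈?)
      ... | false = refl

      qInClique : ∀ i → inClique (f (inj₁ i)) ≡ true
      qInClique i = neighbourOfStable (sStable i) (from (pat i i) (inj₁ refl))

-- The adjacency pattern of the cycle q₀ s₀ q₁ s₁ … q_{k-1} s_{k-1}, where
-- q_i = inj₁ i and s_i = inj₂ i: s_i is adjacent exactly to q_i and q_{i+1 mod k}.
alternating : ∀ {k} → Fin k ⊎ Fin k → Fin k ⊎ Fin k → Set
alternating (inj₂ i) (inj₁ j) = (j ≡ i) ⊎ cycSucc i j
alternating (inj₁ j) (inj₂ i) = (j ≡ i) ⊎ cycSucc i j
alternating (inj₁ _) (inj₁ _) = ⊥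
alternating (inj₂ _) (inj₂ _) = ⊥

-- An induced cycle of length 2k listed by its even (q) and odd (s) vertices.
AlternatingCycle : Graph → ℕ → Set
AlternatingCycle G k =
  Σ (Fin k ⊎ Fin k → V G) λ F →
    Injective _≡_ _≡_ F × (∀ h h' → _~_ G (F h) (F h') ⇔ alternating h h')

double : ℕ → ℕ
double zero    = zero
double (suc k) = suc (suc (double k))

double≡2* : ∀ k → double k ≡ 2 * k
double≡2* zero    = refl
double≡2* (suc k) = cong suc (trans (cong suc (double≡2* k)) (sym (+-suc k (k + 0))))

double-injective : ∀ {a b} → double a ≡ double b → a ≡ b
double-injective {zero}  {zero}  _  = refl
double-injective {suc a} {suc b} eq = cong suc (double-injective (suc-injective (suc-injective eq)))

even≢odd : ∀ {a b} → double a ≢ suc (double b)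
even≢odd {suc a} {suc b} eq = even≢odd {a} {b} (suc-injective (suc-injective eq))

double-zero : ∀ {a} → double a ≡ 0 → a ≡ 0
double-zero {zero} _ = refl

position : ∀ {k} → Fin k ⊎ Fin k → ℕ
position (inj₁ i) = double (toℕ i)
position (inj₂ i) = suc (double (toℕ i))

Succ : ℕ → ℕ → ℕ → Set
Succ N a b = (suc a ≡ b) ⊎ ((suc a ≡ N) × (b ≡ 0))

position-consecutive : ∀ {k} (h h' : Fin k ⊎ Fin k) →
  (Succ (double k) (position h) (position h') ⊎ Succ (double k) (position h') (position h))
  ⇔ alternating h h'
position-consecutive (inj₁ i) (inj₁ j) = mk⇔ parity λ ()
  where
    parity : _ → ⊥
    parity (inj₁ (inj₁ eq))       = even≢odd (sym eq)
    parity (inj₁ (inj₂ (eq , _))) = even≢odd (sym eq)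
    parity (inj₂ (inj₁ eq))       = even≢odd (sym eq)
    parity (inj₂ (inj₂ (eq , _))) = even≢odd (sym eq)
position-consecutive (inj₂ i) (inj₂ j) = mk⇔ parity λ ()
  where
    parity : _ → ⊥
    parity (inj₁ (inj₁ eq))       = even≢odd (sym (suc-injective eq))
    parity (inj₁ (inj₂ (_ , ())))
    parity (inj₂ (inj₁ eq))       = even≢odd (sym (suc-injective eq))
    parity (inj₂ (inj₂ (_ , ())))
position-consecutive {k} (inj₂ i) (inj₁ j) = mk⇔ toPattern fromPattern
  where
    toPattern : _ → alternating (inj₂ i) (inj₁ j)
    toPattern (inj₁ (inj₁ eq))         = inj₂ (inj₁ (double-injective {suc (toℕ i)} eq))
    toPattern (inj₁ (inj₂ (eq , eq'))) = inj₂ (inj₂ (double-injective {suc (toℕ i)} {k} eq , double-zero eq'))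
    toPattern (inj₂ (inj₁ eq))         = inj₁ (toℕ-injective (double-injective (suc-injective eq)))
    toPattern (inj₂ (inj₂ (_ , ())))
    fromPattern : alternating (inj₂ i) (inj₁ j) → _
    fromPattern (inj₁ refl)               = inj₂ (inj₁ refl)
    fromPattern (inj₂ (inj₁ eq))          = inj₁ (inj₁ (cong double eq))
    fromPattern (inj₂ (inj₂ (eq , eq')))  = inj₁ (inj₂ (cong double eq , cong double eq'))
position-consecutive (inj₁ j) (inj₂ i) =
  ⇔.trans (mk⇔ swap swap) (position-consecutive (inj₂ i) (inj₁ j))

interleave : ∀ {k} → Fin k ⊎ Fin k → Fin (double k)
interleave {suc k} (inj₁ fzero)     = fzero
interleave {suc k} (inj₂ fzero)     = fsuc fzero
interleave {suc k} (inj₁ (fsuc i))  = fsuc (fsuc (interleave (inj₁ i)))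
interleave {suc k} (inj₂ (fsuc i))  = fsuc (fsuc (interleave (inj₂ i)))

deinterleave : ∀ {k} → Fin (double k) → Fin k ⊎ Fin k
deinterleave {suc k} fzero               = inj₁ fzero
deinterleave {suc k} (fsuc fzero)        = inj₂ fzero
deinterleave {suc k} (fsuc (fsuc t))     = ⊎-map fsuc fsuc (deinterleave t)

toℕ-interleave : ∀ {k} (h : Fin k ⊎ Fin k) → toℕ (interleave h) ≡ position h
toℕ-interleave {suc k} (inj₁ fzero)    = refl
toℕ-interleave {suc k} (inj₂ fzero)    = refl
toℕ-interleave {suc k} (inj₁ (fsuc i)) = cong (suc ∘ suc) (toℕ-interleave (inj₁ i))
toℕ-interleave {suc k} (inj₂ (fsuc i)) = cong (suc ∘ suc) (toℕ-interleave (inj₂ i))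

deinterleave-interleave : ∀ {k} (h : Fin k ⊎ Fin k) → deinterleave (interleave h) ≡ h
deinterleave-interleave {suc k} (inj₁ fzero)    = refl
deinterleave-interleave {suc k} (inj₂ fzero)    = refl
deinterleave-interleave {suc k} (inj₁ (fsuc i)) = cong (⊎-map fsuc fsuc) (deinterleave-interleave (inj₁ i))
deinterleave-interleave {suc k} (inj₂ (fsuc i)) = cong (⊎-map fsuc fsuc) (deinterleave-interleave (inj₂ i))

interleave-shift : ∀ {k} (h : Fin k ⊎ Fin k) →
                   interleave (⊎-map fsuc fsuc h) ≡ fsuc (fsuc (interleave h))
interleave-shift (inj₁ i) = refl
interleave-shift (inj₂ i) = refl

interleave-deinterleave : ∀ {k} (t : Fin (double k)) → interleave (deinterleave t) ≡ t
interleave-deinterleave {suc k} fzero           = refl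
interleave-deinterleave {suc k} (fsuc fzero)    = refl
interleave-deinterleave {suc k} (fsuc (fsuc t)) =
  trans (interleave-shift (deinterleave t)) (cong (fsuc ∘ fsuc) (interleave-deinterleave t))

interleave-consecutive : ∀ {k} (h h' : Fin k ⊎ Fin k) →
  (cycSucc (interleave h) (interleave h') ⊎ cycSucc (interleave h') (interleave h)) ⇔ alternating h h'
interleave-consecutive {k} h h' =
  subst₂ (λ a b → (Succ (double k) a b ⊎ Succ (double k) b a) ⇔ alternating h h')
         (sym (toℕ-interleave h)) (sym (toℕ-interleave h')) (position-consecutive h h')

alternatingOfCycle : ∀ {G k} → InducedCycle G (double k) → AlternatingCycle G k
alternatingOfCycle (f , inj , adj) =
  f ∘ interleave ,
  retraction⇒injective deinterleave deinterleave-interleave ∘ inj ,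
  λ h h' → ⇔.trans (adj _ _) (interleave-consecutive h h')

cycleOfAlternating : ∀ {G k} → AlternatingCycle G k → InducedCycle G (2 * k)
cycleOfAlternating {G} {k} (F , inj , adj) =
  subst (InducedCycle G) (double≡2* k)
    (F ∘ deinterleave ,
     retraction⇒injective interleave interleave-deinterleave ∘ inj ,
     λ t u → ⇔.trans (adj _ _) (⇔.sym (consecutive t u)))
  where
    consecutive : ∀ t u → (cycSucc t u ⊎ cycSucc u t) ⇔ alternating (deinterleave t) (deinterleave u)
    consecutive t u =
      subst₂ (λ a b → (cycSucc a b ⊎ cycSucc b a) ⇔ alternating (deinterleave t) (deinterleave u))
             (interleave-deinterleave t) (interleave-deinterleave u)
             (interleave-consecutive (deinterleave t) (deinterleave u))

next : ∀ {N} → Fin N → Fin N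
next {N} i with suc (toℕ i) ≟ N
... | yes _    = fromℕ< (≤-trans (s≤s z≤n) (toℕ<n i))
... | no  last = fromℕ< (≤∧≢⇒< (toℕ<n i) last)

next-succ : ∀ {N} (i : Fin N) → cycSucc i (next i)
next-succ {N} i with suc (toℕ i) ≟ N
... | yes wraps = inj₂ (wraps , toℕ-fromℕ< (≤-trans (s≤s z≤n) (toℕ<n i)))
... | no  last  = inj₁ (sym (toℕ-fromℕ< (≤∧≢⇒< (toℕ<n i) last)))

succ-functional : ∀ {N} {i x y : Fin N} → cycSucc i x → cycSucc i y → x ≡ y
succ-functional (inj₁ eq) (inj₁ eq') = toℕ-injective (trans (sym eq) eq')
succ-functional {x = x} (inj₁ eq) (inj₂ (eq' , _)) = ⊥-elim (<⇒≢ (toℕ<n x) (trans (sym eq) eq'))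
succ-functional {y = y} (inj₂ (eq' , _)) (inj₁ eq) = ⊥-elim (<⇒≢ (toℕ<n y) (trans (sym eq) eq'))
succ-functional (inj₂ (_ , x≡0)) (inj₂ (_ , y≡0)) = toℕ-injective (trans x≡0 (sym y≡0))

succ-injective : ∀ {N} {a b x : Fin N} → cycSucc a x → cycSucc b x → a ≡ b
succ-injective (inj₁ eq) (inj₁ eq') = toℕ-injective (suc-injective (trans eq (sym eq')))
succ-injective (inj₁ eq) (inj₂ (_ , x≡0)) with trans eq x≡0
... | ()
succ-injective (inj₂ (_ , x≡0)) (inj₁ eq) with trans eq x≡0
... | ()
succ-injective (inj₂ (eq , _)) (inj₂ (eq' , _)) = toℕ-injective (suc-injective (trans eq (sym eq')))

next-injective : ∀ {N} {i j : Fin N} → next i ≡ next j → i ≡ j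
next-injective {i = i} {j} eq = succ-injective (next-succ i) (subst (cycSucc j) (sym eq) (next-succ j))

next-consecutive : ∀ {N} (t u : Fin N) → cycSucc (next t) (next u) ⇔ cycSucc t u
next-consecutive t u = mk⇔ unshift shift
  where
    unshift : cycSucc (next t) (next u) → cycSucc t u
    unshift t'→u' = subst (cycSucc t) (next-injective (succ-functional (next-succ (next t)) t'→u'))
                          (next-succ t)
    shift : cycSucc t u → cycSucc (next t) (next u)
    shift t→u = subst (λ x → cycSucc (next t) (next x)) (succ-functional (next-succ t) t→u)
                      (next-succ (next t))

rotate : ∀ {G N} → InducedCycle G N → InducedCycle G N
rotate (f , inj , adj) =
  f ∘ next , next-injective ∘ inj ,
  λ t u → ⇔.trans (adj (next t) (next u)) (next-consecutive t u ⊎-⇔ next-consecutive u t)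

inX : ∀ {m n} → Fin m ⊎ Fin n → Bool
inX (inj₁ _) = true
inX (inj₂ _) = false

module Bipartite (B : BipGraph) where

  edge-sides : ∀ {u v} → bipAdj B u v → inX u ≡ not (inX v)
  edge-sides {inj₁ _} {inj₂ _} _ = refl
  edge-sides {inj₂ _} {inj₁ _} _ = refl

  sameSide-nonadjacent : ∀ {u v} → inX u ≡ inX v → ¬ bipAdj B u v
  sameSide-nonadjacent {inj₁ _} {inj₁ _} _ ()
  sameSide-nonadjacent {inj₂ _} {inj₂ _} _ ()

  flip : ℕ → Bool → Bool
  flip zero    b = b
  flip (suc a) b = not (flip a b)

  flip-double : ∀ a b → flip (double a) b ≡ b
  flip-double zero    b = refl
  flip-double (suc a) b = trans (not-involutive _) (flip-double a b)

  module _ {N} (c : InducedCycle (toGraph B) (suc N)) where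
    open CycleFacts {toGraph B} c

    -- Induction on the position a as a natural number: position a + 1 is a
    -- neighbour of position a, hence of the other colour.
    colourAt : ∀ a (a< : a < suc N) → inX (vertex (fromℕ< a<)) ≡ flip a (inX (vertex fzero))
    colourAt zero    _  = refl
    colourAt (suc a) a< =
      trans (edge-sides (~-sym (toGraph B) (consecutive step))) (cong not (colourAt a a<′))
      where
        a<′ : a < suc N
        a<′ = ≤-trans (n≤1+n (suc a)) a<
        step : cycSucc (fromℕ< a<′) (fromℕ< a<)
        step = inj₁ (trans (cong suc (toℕ-fromℕ< a<′)) (sym (toℕ-fromℕ< a<)))

    colour : ∀ t → inX (vertex t) ≡ flip (toℕ t) (inX (vertex fzero))
    colour t = subst (λ x → inX (vertex x) ≡ flip (toℕ t) (inX (vertex fzero)))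
                     (fromℕ<-toℕ t (toℕ<n t)) (colourAt (toℕ t) (toℕ<n t))

  XAlternatingCycle : ℕ → Set
  XAlternatingCycle k =
    Σ (AlternatingCycle (toGraph B) k) λ a →
      (∀ i → inX (proj₁ a (inj₁ i)) ≡ true) × (∀ i → inX (proj₁ a (inj₂ i)) ≡ false)

  fromXStart : ∀ {k} (c : InducedCycle (toGraph B) (double (suc k))) →
               inX (proj₁ c fzero) ≡ true → XAlternatingCycle (suc k)
  fromXStart c start = alternatingOfCycle {toGraph B} c , qInX , sInY
    where
      open CycleFacts {toGraph B} c
      open ≡-Reasoning
      evenColour : ∀ i → inX (vertex (interleave (inj₁ i))) ≡ inX (vertex fzero)
      evenColour i = begin
        inX (vertex (interleave (inj₁ i)))                     ≡⟨ colour c _ ⟩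
        flip (toℕ (interleave (inj₁ i))) (inX (vertex fzero))  ≡⟨ cong (λ a → flip a _) (toℕ-interleave (inj₁ i)) ⟩
        flip (double (toℕ i)) (inX (vertex fzero))             ≡⟨ flip-double (toℕ i) _ ⟩
        inX (vertex fzero)                                     ∎
      qInX : ∀ i → inX (vertex (interleave (inj₁ i))) ≡ true
      qInX i = trans (evenColour i) start
      sInY : ∀ i → inX (vertex (interleave (inj₂ i))) ≡ false
      sInY i = begin
        inX (vertex (interleave (inj₂ i)))                           ≡⟨ colour c _ ⟩
        flip (toℕ (interleave (inj₂ i))) (inX (vertex fzero))        ≡⟨ cong (λ a → flip a _) (toℕ-interleave (inj₂ i)) ⟩
        not (flip (double (toℕ i)) (inX (vertex fzero)))             ≡⟨ cong not (trans (flip-double (toℕ i) _) start) ⟩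
        false                                                        ∎

  -- Every induced 2k-cycle of B (k ≥ 1) yields an X-alternating cycle,
  -- after a rotation by one position if it starts in Y.
  xAlternatingOfCycle : ∀ {k} → InducedCycle (toGraph B) (2 * suc k) → XAlternatingCycle (suc k)
  xAlternatingOfCycle {k} c2k with subst (InducedCycle (toGraph B)) (sym (double≡2* (suc k))) c2k
  ... | c with inX (proj₁ c fzero) in start
  ...   | true  = fromXStart c start
  ...   | false = fromXStart (rotate {toGraph B} c) secondInX
    where
      open CycleFacts {toGraph B} c
      -- position 1 is a neighbour of the Y-vertex at position 0
      secondInX : inX (vertex (next fzero)) ≡ true
      secondInX = trans (edge-sides (~-sym (toGraph B) (consecutive (next-succ fzero)))) (cong not start)

module SplitX (B : BipGraph) where
  open Bipartite B

  splitPartition : SplitPartition (splitX B)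
  splitPartition = record { inClique = inX ; clique = clique ; stable = stable }
    where
      clique : ∀ {u v} → inX u ≡ true → inX v ≡ true → u ≢ v → splitXAdj B u v
      clique {inj₁ _} {inj₁ _} _ _ u≢v = λ eq → u≢v (cong inj₁ eq)
      clique {inj₁ _} {inj₂ _} _ ()
      clique {inj₂ _} ()
      stable : ∀ {u v} → inX u ≡ false → inX v ≡ false → ¬ splitXAdj B u v
      stable {inj₂ _} {inj₂ _} _ _ ()
      stable {inj₂ _} {inj₁ _} _ ()
      stable {inj₁ _} ()

  open SplitPartition splitPartition using (clique; stable)
  open SplitGraph splitPartition using (splitChordal; sunPlacement)

  outsideX : ∀ {u v} → inX u ≡ false → splitXAdj B u v ⇔ bipAdj B u v
  outsideX {inj₂ _} {inj₁ _} _ = ⇔.refl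
  outsideX {inj₂ _} {inj₂ _} _ = ⇔.refl

  sun→alternating : ∀ {k} → 3 ≤ k → InducedSun (splitX B) k → AlternatingCycle (toGraph B) k
  sun→alternating 3≤k s@(f , inj , _ , _ , pat) = f , inj , adjacency
    where
      qInX : ∀ i → inX (f (inj₁ i)) ≡ true
      qInX = proj₁ (sunPlacement 3≤k s)
      sInY : ∀ i → inX (f (inj₂ i)) ≡ false
      sInY = proj₂ (sunPlacement 3≤k s)
      crossing : ∀ i j → bipAdj B (f (inj₂ i)) (f (inj₁ j)) ⇔ alternating (inj₂ i) (inj₁ j)
      crossing i j = ⇔.trans (⇔.sym (outsideX (sInY i))) (pat i j)
      adjacency : ∀ h h' → bipAdj B (f h) (f h') ⇔ alternating h h'
      adjacency (inj₁ i) (inj₁ j) = mk⇔ (sameSide-nonadjacent (trans (qInX i) (sym (qInX j)))) λ ()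
      adjacency (inj₂ i) (inj₂ j) = mk⇔ (sameSide-nonadjacent (trans (sInY i) (sym (sInY j)))) λ ()
      adjacency (inj₂ i) (inj₁ j) = crossing i j
      adjacency (inj₁ j) (inj₂ i) = ⇔.trans (mk⇔ (~-sym (toGraph B)) (~-sym (toGraph B))) (crossing i j)

  xAlternating→sun : ∀ {k} → XAlternatingCycle k → InducedSun (splitX B) k
  xAlternating→sun ((F , inj , adj) , qInX , sInY) =
    F , inj ,
    (λ i j i≢j → clique (qInX i) (qInX j) (λ eq → i≢j (inj₁-injective (inj eq)))) ,
    (λ i j → stable (sInY i) (sInY j)) ,
    λ i j → ⇔.trans (outsideX (sInY i)) (adj (inj₂ i) (inj₁ j))

  stronglyChordal⇔chordalBipartite : StronglyChordal (splitX B) ⇔ ChordalBipartite B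
  stronglyChordal⇔chordalBipartite = mk⇔ chordalBipartite stronglyChordal
    where
      chordalBipartite : StronglyChordal (splitX B) → ChordalBipartite B
      chordalBipartite (_ , sunFree) (suc k) 3≤k c =
        sunFree (suc k) 3≤k (xAlternating→sun (xAlternatingOfCycle c))
      stronglyChordal : ChordalBipartite B → StronglyChordal (splitX B)
      stronglyChordal cb =
        splitChordal , λ k 3≤k s → cb k 3≤k (cycleOfAlternating {toGraph B} (sun→alternating 3≤k s))

transpose : BipGraph → BipGraph
transpose B = record { m = n B ; n = m B ; E = λ y x → E B x y }

-- Between distinct vertices, a non-edge of B is an edge of mir(B).
complementEdge : ∀ {A : Set} (b : Bool) → A → (A × ¬ (b ≡ true)) ⇔ (not b ≡ true)
complementEdge true  _ = mk⇔ (λ (_ , nonEdge) → ⊥-elim (nonEdge refl)) λ ()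
complementEdge false a = mk⇔ (λ _ → refl) (λ _ → a , λ ())

module Isomorphisms (B : BipGraph) where

  transpose-≅ : toGraph (transpose B) ≅ toGraph B
  transpose-≅ = bijectionIso swap swap swap-involutive swap-involutive adjacency
    where
      adjacency : ∀ u v → bipAdj (transpose B) u v ⇔ bipAdj B (swap u) (swap v)
      adjacency (inj₁ _) (inj₁ _) = ⇔.refl
      adjacency (inj₁ _) (inj₂ _) = ⇔.refl
      adjacency (inj₂ _) (inj₁ _) = ⇔.refl
      adjacency (inj₂ _) (inj₂ _) = ⇔.refl

  splitY-≅ : splitY B ≅ splitX (transpose B)
  splitY-≅ = bijectionIso swap swap swap-involutive swap-involutive adjacency
    where
      adjacency : ∀ u v → splitYAdj B u v ⇔ splitXAdj (transpose B) (swap u) (swap v)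
      adjacency (inj₁ _) (inj₁ _) = ⇔.refl
      adjacency (inj₁ _) (inj₂ _) = ⇔.refl
      adjacency (inj₂ _) (inj₁ _) = ⇔.refl
      adjacency (inj₂ _) (inj₂ _) = ⇔.refl

  -- Complementing split_X(B) makes X stable, Y a clique and the X–Y edges
  -- those of mir(B): complement(split_X B) ≅ split_Y(mir B).
  complement-splitX : complement (splitX B) ≅ splitY (mirror B)
  complement-splitX = bijectionIso id id (λ _ → refl) (λ _ → refl) adjacency
    where
      adjacency : ∀ u v → ((u ≢ v) × ¬ splitXAdj B u v) ⇔ splitYAdj (mirror B) u v
      adjacency (inj₁ _) (inj₁ _) = mk⇔ (λ (u≢v , ¬x≢x') → ¬x≢x' (λ eq → u≢v (cong inj₁ eq))) λ ()
      adjacency (inj₂ _) (inj₂ _) =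
        mk⇔ (λ (u≢v , _) eq → u≢v (cong inj₂ eq)) (λ y≢y' → (λ eq → y≢y' (inj₂-injective eq)) , λ ())
      adjacency (inj₁ x) (inj₂ y) = complementEdge (E B x y) (λ ())
      adjacency (inj₂ y) (inj₁ x) = complementEdge (E B x y) (λ ())

  complement-splitY : complement (splitY B) ≅ splitX (mirror B)
  complement-splitY = bijectionIso id id (λ _ → refl) (λ _ → refl) adjacency
    where
      adjacency : ∀ u v → ((u ≢ v) × ¬ splitYAdj B u v) ⇔ splitXAdj (mirror B) u v
      adjacency (inj₂ _) (inj₂ _) = mk⇔ (λ (u≢v , ¬y≢y') → ¬y≢y' (λ eq → u≢v (cong inj₂ eq))) λ ()
      adjacency (inj₁ _) (inj₁ _) =
        mk⇔ (λ (u≢v , _) eq → u≢v (cong inj₁ eq)) (λ x≢x' → (λ eq → x≢x' (inj₁-injective eq)) , λ ())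
      adjacency (inj₁ x) (inj₂ y) = complementEdge (E B x y) (λ ())
      adjacency (inj₂ y) (inj₁ x) = complementEdge (E B x y) (λ ())

  chordalBipartite-transpose : ChordalBipartite (transpose B) ⇔ ChordalBipartite B
  chordalBipartite-transpose =
    mk⇔ (λ cb k 3≤k c → cb k 3≤k (cycle-↪ (inverse transpose-≅) c))
        (λ cb k 3≤k c → cb k 3≤k (cycle-↪ (embedding transpose-≅) c))

open SplitX using (stronglyChordal⇔chordalBipartite)
open Isomorphisms

splitY-stronglyChordal⇔chordalBipartite : ∀ B → StronglyChordal (splitY B) ⇔ ChordalBipartite B
splitY-stronglyChordal⇔chordalBipartite B =
  ⇔.trans (stronglyChordal-≅ (splitY-≅ B))
          (⇔.trans (stronglyChordal⇔chordalBipartite (transpose B)) (chordalBipartite-transpose B))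

-- B is ACB iff split_X(B) is auto-strongly-chordal iff split_Y(B) is: each
-- of the two split graphs and its complement is a split_X or split_Y of B or
-- of mir(B).
corollary1 : (B : BipGraph) →
    (ACB B ⇔ AutoStronglyChordal (splitX B)) × (ACB B ⇔ AutoStronglyChordal (splitY B))
corollary1 B =
  ⇔.sym (stronglyChordal⇔chordalBipartite B
         ×-⇔ ⇔.trans (stronglyChordal-≅ (complement-splitX B))
                     (splitY-stronglyChordal⇔chordalBipartite (mirror B))) ,
  ⇔.sym (splitY-stronglyChordal⇔chordalBipartite B
         ×-⇔ ⇔.trans (stronglyChordal-≅ (complement-splitY B))
                     (stronglyChordal⇔chordalBipartite (mirror B)))
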